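{- (i) Let $b=4k$ with $k\ge1$ and $t\ge3$. Let $\mathcal H^2(b,t)$ be the $(0,1,2)$-multigraph constructed as follows: take a cycle $x_1y_1x_2y_2\cdots x_ty_tx_1$ of length $2t$ all of whose edges are single edges; for each $i$, join $y_i$ by a single edge to a new vertex $z_i$, join $z_i$ by double edges to $b/4$ new pendent vertices, and join $y_i$ by double edges to $(b-4)/4$ new pendent vertices. (Thus $d(x_i)=2$, $d(y_i)=d(z_i)=1+\frac b2$, and every pendent vertex has degree $2$.) (ii) Let $b=4k+2$ with $k\ge1$ and $t\ge3$. Let $\mathcal H^3(b,t)$ be the $(0,1,2)$-multigraph constructed as follows: take a cycle $x_1y_1z_1x_2y_2z_2\cdots x_ty_tz_tx_1$ of length $3t$ all of whose edges are single edges; for each $i$, join each of $y_i$ and $z_i$ by double edges to $k=(b-2)/4$ new pendent vertices. (Thus $d(x_i)=2$, $d(y_i)=d(z_i)=1+\frac b2$, and every pendent vertex has degree $2$.) Then every $H\in\{\mathcal H^2(b,t),\mathcal H^3(b,t)\}$ has exactly two distinct main eigenvalues.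
   Context: A $(0,1,2)$-multigraph is a loopless multigraph in which any two distinct vertices $u,v$ are joined by $w(u,v)\in\{0,1,2\}$ edges ("single edge" means $w=1$, "double edge" means $w=2$); its adjacency matrix has $(u,v)$-entry $w(u,v)$, and $d(v)=\sum_u w(u,v)$. A pendent vertex is one with exactly one neighbour. An eigenvalue of the adjacency matrix is a main eigenvalue if its eigenspace is not orthogonal to the all-ones vector; the count is of distinct such eigenvalues. -}

module Defs where

open import Level using (Level; _⊔_) renaming (suc to lsuc)
open import Data.Nat as ℕ using (ℕ; zero; suc; _∸_)
open import Data.Bool using (Bool; true; false; _∧_; _∨_; if_then_else_)
open import Data.Fin using (Fin; toℕ)
open import Data.List using (List; []; _∷_; _++_; map; concatMap; foldr; allFin)
open import Data.Vec using (Vec; []; _∷_)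
open import Data.Product using (Σ; ∃; _×_; _,_)
open import Data.Sum using (_⊎_)
open import Relation.Nullary using (¬_)
open import Algebra.Bundles using (CommutativeRing)

-- Real closed fields (the setting for real eigenvalues; every real
-- closed field is elementarily equivalent to ℝ, so eigenvalue statements
-- about a fixed integer matrix transfer).

-- Monic polynomial  x^n + a_{n-1} x^{n-1} + … + a_0 , coefficients given
-- as the vector (a_0 , … , a_{n-1}).
module _ {c ℓ} (R : CommutativeRing c ℓ) where
  open CommutativeRing R

  evalMonic : ∀ {n} → Vec Carrier n → Carrier → Carrier
  evalMonic [] x = 1#
  evalMonic (a ∷ as) x = a + x * evalMonic as x

record RealClosedField c ℓ ℓ≤ : Set (lsuc (c ⊔ ℓ ⊔ ℓ≤)) where
  field
    commRing : CommutativeRing c ℓ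
  open CommutativeRing commRing public
  field
    _≤_          : Carrier → Carrier → Set ℓ≤
    ≤-refl       : ∀ {x y} → x ≈ y → x ≤ y
    ≤-antisym    : ∀ {x y} → x ≤ y → y ≤ x → x ≈ y
    ≤-trans      : ∀ {x y z} → x ≤ y → y ≤ z → x ≤ z
    ≤-total      : ∀ x y → x ≤ y ⊎ y ≤ x
    +-mono-≤     : ∀ {x y} z → x ≤ y → (x + z) ≤ (y + z)
    *-nonneg     : ∀ {x y} → 0# ≤ x → 0# ≤ y → 0# ≤ (x * y)
    0≉1          : ¬ (0# ≈ 1#)
    inverse      : ∀ x → ¬ (x ≈ 0#) → ∃ λ y → (x * y) ≈ 1#
    sqrt         : ∀ x → 0# ≤ x → ∃ λ y → (y * y) ≈ x
    oddRoot      : ∀ m (as : Vec Carrier (suc (2 ℕ.* m))) →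
                   ∃ λ x → evalMonic commRing as x ≈ 0#

-- Finite (0,1,2)-multigraphs given by a vertex type, an enumeration of
-- the vertices (each exactly once) and a symmetric weight w(u,v) ∈ {0,1,2}.

record Multigraph : Set₁ where
  field
    V        : Set
    vertices : List V
    w        : V → V → ℕ

module Spectral {c ℓ ℓ≤} (F : RealClosedField c ℓ ℓ≤) (G : Multigraph) where
  open RealClosedField F
  open Multigraph G

  fromℕ : ℕ → Carrier
  fromℕ zero = 0#
  fromℕ (suc n) = 1# + fromℕ n

  sumV : (V → Carrier) → Carrier
  sumV f = foldr (λ u s → f u + s) 0# vertices

  adjMul : (V → Carrier) → V → Carrier
  adjMul v u = sumV (λ x → fromℕ (w u x) * v x)

  IsMainEigenvalue : Carrier → Set (c ⊔ ℓ)
  IsMainEigenvalue λ₀ = Σ (V → Carrier) λ v →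
    (∀ u → adjMul v u ≈ λ₀ * v u) × ¬ (sumV v ≈ 0#)

  ExactlyTwoMainEigenvalues : Set (c ⊔ ℓ)
  ExactlyTwoMainEigenvalues = Σ Carrier λ λ₁ → Σ Carrier λ λ₂ →
    ¬ (λ₁ ≈ λ₂) × IsMainEigenvalue λ₁ × IsMainEigenvalue λ₂ ×
    (∀ μ → IsMainEigenvalue μ → μ ≈ λ₁ ⊎ μ ≈ λ₂)

eqF : ∀ {t} → Fin t → Fin t → Bool
eqF i j = toℕ i ℕ.≡ᵇ toℕ j

isNext : ∀ {t} → Fin t → Fin t → Bool
isNext {t} i j = (suc (toℕ i) ℕ.≡ᵇ toℕ j) ∨ ((suc (toℕ i) ℕ.≡ᵇ t) ∧ (toℕ j ℕ.≡ᵇ 0))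

ifB : Bool → ℕ → ℕ
ifB b n = if b then n else 0

-- 𝓗²(b,t) with b = 4k :
-- cycle x₁y₁x₂y₂…x_ty_tx₁ (single edges), y_i – z_i single edge,
-- z_i joined by double edges to k = b/4 pendent vertices p(i,·),
-- y_i joined by double edges to k-1 = (b-4)/4 pendent vertices q(i,·).

data V² (k t : ℕ) : Set where
  x y z : Fin t → V² k t
  p     : Fin t → Fin k → V² k t
  q     : Fin t → Fin (k ∸ 1) → V² k t

-- each edge listed once, in one orientation, with its multiplicity
e² : ∀ {k t} → V² k t → V² k t → ℕ
e² (x i) (y j)   = ifB (eqF i j) 1
e² (y i) (x j)   = ifB (isNext i j) 1
e² (y i) (z j)   = ifB (eqF i j) 1
e² (z i) (p j l) = ifB (eqF i j) 2
e² (y i) (q j l) = ifB (eqF i j) 2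
e² _ _ = 0

H² : (k t : ℕ) → Multigraph
H² k t = record
  { V = V² k t
  ; vertices = concatMap (λ i → x i ∷ y i ∷ z i ∷ (map (p i) (allFin k) ++ map (q i) (allFin (k ∸ 1))))
                         (allFin t)
  ; w = λ u v → e² u v ℕ.+ e² v u
  }

-- 𝓗³(b,t) with b = 4k+2 :
-- cycle x₁y₁z₁x₂y₂z₂…x_ty_tz_tx₁ (single edges), y_i joined by double
-- edges to k pendent vertices p(i,·), z_i to k pendent vertices q(i,·).

data V³ (k t : ℕ) : Set where
  x y z : Fin t → V³ k t
  p q   : Fin t → Fin k → V³ k t

e³ : ∀ {k t} → V³ k t → V³ k t → ℕ
e³ (x i) (y j)   = ifB (eqF i j) 1
e³ (y i) (z j)   = ifB (eqF i j) 1
e³ (z i) (x j)   = ifB (isNext i j) 1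
e³ (y i) (p j l) = ifB (eqF i j) 2
e³ (z i) (q j l) = ifB (eqF i j) 2
e³ _ _ = 0

H³ : (k t : ℕ) → Multigraph
H³ k t = record
  { V = V³ k t
  ; vertices = concatMap (λ i → x i ∷ y i ∷ z i ∷ (map (p i) (allFin k) ++ map (q i) (allFin k)))
                         (allFin t)
  ; w = λ u v → e³ u v ℕ.+ e³ v u
  }

module Submission where

-- Let A be the adjacency matrix, 𝟙 the all-ones vector, d = A𝟙 the degree vector, N the
-- number of vertices, S = 𝟙ᵀd and C = b (that is 4k for 𝓗² and 4k + 2 for 𝓗³). The partition
-- of the vertices into the classes {xᵢ}, {yᵢ}, {zᵢ}, {pᵢₗ}, {qᵢₗ} is equitable, and a computation
-- with its 5 × 5 quotient matrix shows A d = d + C𝟙. So if λ₁, λ₂ are the roots of X² − X − C,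
-- then A (d − λ₂𝟙) = λ₁ (d − λ₂𝟙) and symmetrically; both eigenvectors are main because
-- 𝟙ᵀ(d − λ𝟙) = S − λN vanishes only when the mean degree S/N is a root of X² − X − C, which
-- S² < SN + CN² rules out. Conversely, if A v = μ v and 𝟙ᵀv ≠ 0, the symmetry of A gives
-- μ 𝟙ᵀv = dᵀv and μ dᵀv = (A d)ᵀv = dᵀv + C 𝟙ᵀv, hence μ² = μ + C.

open import Defs
open import Level using (Level; _⊔_)
open import Function using (_∘_)
open import Data.Bool using (Bool; true; false; _∨_; T)
import Data.Bool.Properties as Bool
open import Data.Nat as ℕ using (ℕ; zero; suc; s≤s; z≤n)
import Data.Nat.Properties as ℕ
open import Data.Nat.Tactic.RingSolver using (solve-∀)
open import Data.Integer as ℤ using (ℤ; -[1+_]; _⊖_; _◃_; sign; ∣_∣)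
open import Data.Integer.Properties using ([1+m]⊖[1+n]≡m⊖n)
open import Data.Sign as Sign using (Sign)
open import Data.Fin using (Fin; toℕ) renaming (zero to fzero; suc to fsuc)
open import Data.Fin.Properties using (toℕ<n)
open import Data.List using (List; []; _∷_; _++_; map; concatMap; foldr; allFin; tabulate)
open import Data.Maybe using (Maybe; just; nothing)
open import Data.Product using (_,_; proj₁; proj₂)
open import Data.Sum as Sum using (_⊎_; inj₁; inj₂)
open import Relation.Nullary using (¬_; yes; no; contradiction)
open import Relation.Binary.Definitions using (tri<; tri≈; tri>)
open import Relation.Binary.PropositionalEquality as ≡ using (_≡_; _≢_)
open import Algebra.Bundles using (CommutativeRing; CommutativeSemiring)
open import Algebra.Solver.Ring.AlmostCommutativeRing using (fromCommutativeRing; _-Raw-AlmostCommutative⟶_)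

-- The library's ring solver needs a coefficient ring mapped into R, and ℤ maps into every
-- commutative ring. The optimised _×_ is used so that the constant con (+ 1) is 1# itself.
module ℤ-Coefficients {c ℓ} (R : CommutativeRing c ℓ) where
  open CommutativeRing R
  open import Data.Integer using (+_)
  open import Algebra.Properties.Ring ring
    using (-‿distribˡ-*; -‿distribʳ-*; -‿involutive; -0#≈0#; -‿+-comm; xyx⁻¹≈y)
  open import Algebra.Properties.Semiring.Mult.TCOptimised semiring using (_×_; ×-homo-+; ×1-homo-*)
  open import Relation.Binary.Reasoning.Setoid setoid

  fromℤ : ℤ → Carrier
  fromℤ (+ n)    = n × 1#
  fromℤ -[1+ n ] = - (suc n × 1#)

  fromℤ-⊖ : ∀ m n → fromℤ (m ⊖ n) ≈ m × 1# - n × 1#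
  fromℤ-⊖ zero    zero    = sym (-‿inverseʳ 0#)
  fromℤ-⊖ zero    (suc n) = sym (+-identityˡ _)
  fromℤ-⊖ (suc m) zero    = sym (trans (+-congˡ -0#≈0#) (+-identityʳ _))
  fromℤ-⊖ (suc m) (suc n) = begin
    fromℤ (suc m ⊖ suc n)    ≡⟨ ≡.cong fromℤ ([1+m]⊖[1+n]≡m⊖n m n) ⟩
    fromℤ (m ⊖ n)            ≈⟨ fromℤ-⊖ m n ⟩
    a - b                    ≈⟨ xyx⁻¹≈y 1# (a - b) ⟨
    1# + (a - b) - 1#        ≈⟨ +-congʳ (+-assoc 1# a (- b)) ⟨
    1# + a - b - 1#          ≈⟨ +-assoc (1# + a) (- b) (- 1#) ⟩
    1# + a + (- b - 1#)      ≈⟨ +-congˡ (trans (-‿+-comm b 1#) (-‿cong (+-comm b 1#))) ⟩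
    1# + a - (1# + b)        ≈⟨ +-cong (×-homo-+ 1# 1 m) (-‿cong (×-homo-+ 1# 1 n)) ⟨
    suc m × 1# - suc n × 1#  ∎
    where
    a = m × 1#
    b = n × 1#

  fromℤ-+ : ∀ i j → fromℤ (i ℤ.+ j) ≈ fromℤ i + fromℤ j
  fromℤ-+ (+ m)    (+ n)    = ×-homo-+ 1# m n
  fromℤ-+ (+ m)    -[1+ n ] = fromℤ-⊖ m (suc n)
  fromℤ-+ -[1+ m ] (+ n)    = trans (fromℤ-⊖ n (suc m)) (+-comm _ _)
  fromℤ-+ -[1+ m ] -[1+ n ] = begin
    - (suc (suc (m ℕ.+ n)) × 1#)  ≡⟨ ≡.cong (λ k → - (suc k × 1#)) (ℕ.+-suc m n) ⟨
    - ((suc m ℕ.+ suc n) × 1#)    ≈⟨ -‿cong (×-homo-+ 1# (suc m) (suc n)) ⟩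
    - (suc m × 1# + suc n × 1#)   ≈⟨ -‿+-comm _ _ ⟨
    - (suc m × 1#) - suc n × 1#   ∎

  signed : Sign → Carrier → Carrier
  signed Sign.+ a = a
  signed Sign.- a = - a

  signed-cong : ∀ s {a b} → a ≈ b → signed s a ≈ signed s b
  signed-cong Sign.+ a≈b = a≈b
  signed-cong Sign.- a≈b = -‿cong a≈b

  signed-* : ∀ s s′ a b → signed (s Sign.* s′) (a * b) ≈ signed s a * signed s′ b
  signed-* Sign.+ Sign.+ a b = refl
  signed-* Sign.+ Sign.- a b = -‿distribʳ-* a b
  signed-* Sign.- Sign.+ a b = -‿distribˡ-* a b
  signed-* Sign.- Sign.- a b = begin
    a * b        ≈⟨ *-congʳ (-‿involutive a) ⟨
    - - a * b    ≈⟨ -‿distribˡ-* (- a) b ⟨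
    - (- a * b)  ≈⟨ -‿distribʳ-* (- a) b ⟩
    - a * - b    ∎

  fromℤ-◃ : ∀ s n → fromℤ (s ◃ n) ≈ signed s (n × 1#)
  fromℤ-◃ Sign.+ zero    = refl
  fromℤ-◃ Sign.- zero    = sym -0#≈0#
  fromℤ-◃ Sign.+ (suc n) = refl
  fromℤ-◃ Sign.- (suc n) = refl

  fromℤ-signed : ∀ i → fromℤ i ≈ signed (sign i) (∣ i ∣ × 1#)
  fromℤ-signed (+ n)    = refl
  fromℤ-signed -[1+ n ] = refl

  fromℤ-* : ∀ i j → fromℤ (i ℤ.* j) ≈ fromℤ i * fromℤ j
  fromℤ-* i j = begin
    fromℤ (s ◃ (∣ i ∣ ℕ.* ∣ j ∣))                               ≈⟨ fromℤ-◃ s (∣ i ∣ ℕ.* ∣ j ∣) ⟩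
    signed s ((∣ i ∣ ℕ.* ∣ j ∣) × 1#)                           ≈⟨ signed-cong s (×1-homo-* ∣ i ∣ ∣ j ∣) ⟩
    signed s (∣ i ∣ × 1# * ∣ j ∣ × 1#)                          ≈⟨ signed-* (sign i) (sign j) _ _ ⟩
    signed (sign i) (∣ i ∣ × 1#) * signed (sign j) (∣ j ∣ × 1#)  ≈⟨ *-cong (fromℤ-signed i) (fromℤ-signed j) ⟨
    fromℤ i * fromℤ j                                           ∎
    where
    s = sign i Sign.* sign j

  fromℤ-neg : ∀ i → fromℤ (ℤ.- i) ≈ - fromℤ i
  fromℤ-neg (+ zero)  = sym -0#≈0#
  fromℤ-neg (+ suc n) = refl
  fromℤ-neg -[1+ n ]  = sym (-‿involutive _)

  fromℤ-morphism : ℤ.+-*-rawRing -Raw-AlmostCommutative⟶ fromCommutativeRing R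
  fromℤ-morphism = record
    { ⟦_⟧    = fromℤ
    ; +-homo = fromℤ-+
    ; *-homo = fromℤ-*
    ; -‿homo = fromℤ-neg
    ; 0-homo = refl
    ; 1-homo = refl
    }

  fromℤ-≟ : ∀ i j → Maybe (fromℤ i ≈ fromℤ j)
  fromℤ-≟ i j with i ℤ.≟ j
  ... | yes ≡.refl = just refl
  ... | no _       = nothing

  open import Algebra.Solver.Ring ℤ.+-*-rawRing (fromCommutativeRing R) fromℤ-morphism fromℤ-≟ public

module OrderedField {c ℓ ℓ≤} (F : RealClosedField c ℓ ℓ≤) where
  open RealClosedField F
  open ℤ-Coefficients commRing
  open import Data.Integer using (+_)
  open import Algebra.Properties.Ring ring using (x∙y⁻¹≈ε⇒x≈y; x≈y⇒x∙y⁻¹≈ε; +-cancelˡ; +-cancelʳ; -0#≈0#)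
  open import Algebra.Properties.Semiring.Mult.TCOptimised semiring using (_×_; ×-homo-+)
  open import Relation.Binary.Reasoning.Setoid setoid

  ≤-cong : ∀ {a a′ b b′} → a ≈ a′ → b ≈ b′ → a ≤ b → a′ ≤ b′
  ≤-cong a≈a′ b≈b′ a≤b = ≤-trans (≤-refl (sym a≈a′)) (≤-trans a≤b (≤-refl b≈b′))

  x≤y⇒0≤y-x : ∀ {a b} → a ≤ b → 0# ≤ (b - a)
  x≤y⇒0≤y-x {a} a≤b = ≤-cong (-‿inverseʳ a) refl (+-mono-≤ (- a) a≤b)

  0≤-x⇒x≤0 : ∀ {a} → 0# ≤ (- a) → a ≤ 0#
  0≤-x⇒x≤0 {a} 0≤-a = ≤-cong (+-identityˡ a) (-‿inverseˡ a) (+-mono-≤ a 0≤-a)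

  0≤x*x : ∀ a → 0# ≤ (a * a)
  0≤x*x a with ≤-total 0# a
  ... | inj₁ 0≤a = *-nonneg 0≤a 0≤a
  ... | inj₂ a≤0 = ≤-cong refl (solve 1 (λ a → :- a :* :- a := a :* a) refl a) (*-nonneg 0≤-a 0≤-a)
    where
    0≤-a : 0# ≤ (- a)
    0≤-a = ≤-cong refl (+-identityˡ (- a)) (x≤y⇒0≤y-x a≤0)

  0≤1 : 0# ≤ 1#
  0≤1 = ≤-cong refl (*-identityˡ 1#) (0≤x*x 1#)

  0≤+ : ∀ {a b} → 0# ≤ a → 0# ≤ b → 0# ≤ (a + b)
  0≤+ {a} {b} 0≤a 0≤b = ≤-trans 0≤b (≤-cong (+-identityˡ b) refl (+-mono-≤ b 0≤a))

  1+x≉0 : ∀ {a} → 0# ≤ a → ¬ (1# + a ≈ 0#)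
  1+x≉0 {a} 0≤a 1+a≈0 = 0≉1 (≤-antisym 0≤1 1≤0)
    where
    1≤0 : 1# ≤ 0#
    1≤0 = ≤-cong (+-identityʳ 1#) 1+a≈0 (≤-cong (+-comm 0# 1#) (+-comm a 1#) (+-mono-≤ 1# 0≤a))

  1+n×1 : ∀ n → suc n × 1# ≈ 1# + n × 1#
  1+n×1 = ×-homo-+ 1# 1

  0≤n×1 : ∀ n → 0# ≤ (n × 1#)
  0≤n×1 zero    = ≤-refl refl
  0≤n×1 (suc n) = ≤-cong refl (sym (1+n×1 n)) (0≤+ 0≤1 (0≤n×1 n))

  1+n×1≉0 : ∀ n → ¬ (suc n × 1# ≈ 0#)
  1+n×1≉0 n = 1+x≉0 (0≤n×1 n) ∘ trans (sym (1+n×1 n))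

  <⇒×1≉ : ∀ {m n} → m ℕ.< n → ¬ (m × 1# ≈ n × 1#)
  <⇒×1≉ {m} {n} m<n m≈n with ℕ.m≤n⇒∃[o]m+o≡n m<n
  ... | o , 1+m+o≡n = 1+n×1≉0 o (sym (+-cancelˡ (m × 1#) 0# (suc o × 1#) (begin
    m × 1# + 0#          ≈⟨ +-identityʳ _ ⟩
    m × 1#               ≈⟨ m≈n ⟩
    n × 1#               ≡⟨ ≡.cong (_× 1#) (≡.trans (ℕ.+-suc m o) 1+m+o≡n) ⟨
    (m ℕ.+ suc o) × 1#   ≈⟨ ×-homo-+ 1# m (suc o) ⟩
    m × 1# + suc o × 1#  ∎)))

  ×1-injective : ∀ {m n} → m × 1# ≈ n × 1# → m ≡ n
  ×1-injective {m} {n} m≈n with ℕ.<-cmp m n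
  ... | tri< m<n _ _ = contradiction m≈n (<⇒×1≉ m<n)
  ... | tri≈ _ m≡n _ = m≡n
  ... | tri> _ _ n<m = contradiction (sym m≈n) (<⇒×1≉ n<m)

  *-cancelʳ-≉0 : ∀ {a b} → a * b ≈ 0# → ¬ (b ≈ 0#) → a ≈ 0#
  *-cancelʳ-≉0 {a} {b} ab≈0 b≉0 with inverse b b≉0
  ... | b⁻¹ , bb⁻¹≈1 = begin
    a              ≈⟨ *-identityʳ a ⟨
    a * 1#         ≈⟨ *-congˡ bb⁻¹≈1 ⟨
    a * (b * b⁻¹)  ≈⟨ *-assoc a b b⁻¹ ⟨
    a * b * b⁻¹    ≈⟨ *-congʳ ab≈0 ⟩
    0# * b⁻¹       ≈⟨ zeroˡ b⁻¹ ⟩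
    0#             ∎

  idempotent≤complement⇒0 : ∀ {e} → e * e ≈ e → e ≤ (1# - e) → e ≈ 0#
  idempotent≤complement⇒0 {e} e²≈e e≤1-e = ≤-antisym (0≤-x⇒x≤0 0≤-e) 0≤e
    where
    0≤e : 0# ≤ e
    0≤e = ≤-cong refl e²≈e (0≤x*x e)
    [1-e-e]e≈-e : (1# - e - e) * e ≈ - e
    [1-e-e]e≈-e = begin
      (1# - e - e) * e     ≈⟨ solve 1 (λ e → (con (+ 1) :- e :- e) :* e := e :- (e :* e :+ e :* e)) refl e ⟩
      e - (e * e + e * e)  ≈⟨ +-congˡ (-‿cong (+-cong e²≈e e²≈e)) ⟩
      e - (e + e)          ≈⟨ solve 1 (λ e → e :- (e :+ e) := :- e) refl e ⟩
      - e                  ∎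
    0≤-e : 0# ≤ (- e)
    0≤-e = ≤-cong refl [1-e-e]e≈-e (*-nonneg (x≤y⇒0≤y-x e≤1-e) 0≤e)

  idempotent⇒0⊎1 : ∀ {e} → e * e ≈ e → e ≈ 0# ⊎ e ≈ 1#
  idempotent⇒0⊎1 {e} e²≈e with ≤-total e (1# - e)
  ... | inj₁ e≤1-e = inj₁ (idempotent≤complement⇒0 e²≈e e≤1-e)
  ... | inj₂ 1-e≤e = inj₂ (x∙y⁻¹≈ε⇒x≈y e 1# (begin
    e - 1#  ≈⟨ solve 1 (λ e → e :- con (+ 1) := :- (con (+ 1) :- e)) refl e ⟩
    - f     ≈⟨ -‿cong (idempotent≤complement⇒0 f²≈f f≤1-f) ⟩
    - 0#    ≈⟨ -0#≈0# ⟩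
    0#      ∎))
    where
    f = 1# - e
    f²≈f : f * f ≈ f
    f²≈f = begin
      f * f               ≈⟨ solve 1 (λ e → (con (+ 1) :- e) :* (con (+ 1) :- e)
                                            := con (+ 1) :- e :- e :+ e :* e) refl e ⟩
      1# - e - e + e * e  ≈⟨ +-congˡ e²≈e ⟩
      1# - e - e + e      ≈⟨ solve 1 (λ e → con (+ 1) :- e :- e :+ e := con (+ 1) :- e) refl e ⟩
      f                   ∎
    f≤1-f : f ≤ (1# - f)
    f≤1-f = ≤-cong refl (solve 1 (λ e → e := con (+ 1) :- (con (+ 1) :- e)) refl e) 1-e≤e

  -- Equality in F is not decidable, so μ - a ≈ 0# cannot be tested directly; instead
  -- (μ - a) / (b - a) is an idempotent, and idempotents are decided by the total order.
  roots-of-product : ∀ {μ a b} → (μ - a) * (μ - b) ≈ 0# → ¬ (a ≈ b) → μ ≈ a ⊎ μ ≈ b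
  roots-of-product {μ} {a} {b} prod≈0 a≉b with inverse (b - a) (a≉b ∘ sym ∘ x∙y⁻¹≈ε⇒x≈y b a)
  ... | d , [b-a]d≈1 = Sum.map e≈0⇒μ≈a e≈1⇒μ≈b (idempotent⇒0⊎1 e²≈e)
    where
    e = (μ - a) * d
    μ-a≈e[b-a] : μ - a ≈ e * (b - a)
    μ-a≈e[b-a] = begin
      μ - a                    ≈⟨ *-identityʳ _ ⟨
      (μ - a) * 1#             ≈⟨ *-congˡ [b-a]d≈1 ⟨
      (μ - a) * ((b - a) * d)  ≈⟨ solve 4 (λ μ a b d → (μ :- a) :* ((b :- a) :* d)
                                                       := (μ :- a) :* d :* (b :- a)) refl μ a b d ⟩
      e * (b - a)              ∎
    e²≈e : e * e ≈ e
    e²≈e = begin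
      e * e
        ≈⟨ solve 4 (λ μ a b d → (μ :- a) :* d :* ((μ :- a) :* d)
                                := (μ :- a) :* (μ :- b) :* (d :* d) :+ (μ :- a) :* d :* ((b :- a) :* d))
                   refl μ a b d ⟩
      (μ - a) * (μ - b) * (d * d) + e * ((b - a) * d)
        ≈⟨ +-cong (*-congʳ prod≈0) (*-congˡ [b-a]d≈1) ⟩
      0# * (d * d) + e * 1#
        ≈⟨ solve 2 (λ dd e → con (+ 0) :* dd :+ e :* con (+ 1) := e) refl (d * d) e ⟩
      e ∎
    e≈0⇒μ≈a : e ≈ 0# → μ ≈ a
    e≈0⇒μ≈a e≈0 = x∙y⁻¹≈ε⇒x≈y μ a (trans μ-a≈e[b-a] (trans (*-congʳ e≈0) (zeroˡ _)))
    e≈1⇒μ≈b : e ≈ 1# → μ ≈ b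
    e≈1⇒μ≈b e≈1 = +-cancelʳ (- a) μ b (trans μ-a≈e[b-a] (trans (*-congʳ e≈1) (*-identityˡ _)))

  vieta⇒root : ∀ {a b C} → a + b ≈ 1# → a * b ≈ - C → a * a ≈ a + C
  vieta⇒root {a} {b} {C} a+b≈1 ab≈-C = begin
    a * a                ≈⟨ solve 2 (λ a b → a :* a := a :* (a :+ b) :- a :* b) refl a b ⟩
    a * (a + b) - a * b  ≈⟨ +-cong (*-congˡ a+b≈1) (-‿cong ab≈-C) ⟩
    a * 1# - - C         ≈⟨ solve 2 (λ a C → a :* con (+ 1) :- :- C := a :+ C) refl a C ⟩
    a + C                ∎

  record QuadraticRoots (C : Carrier) : Set (c ⊔ ℓ) where
    field
      root₁ root₂ : Carrier
      distinct    : ¬ (root₁ ≈ root₂)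
      sum≈1       : root₁ + root₂ ≈ 1#
      product≈-C  : root₁ * root₂ ≈ - C

    sum≈1′ : root₂ + root₁ ≈ 1#
    sum≈1′ = trans (+-comm _ _) sum≈1

    product≈-C′ : root₂ * root₁ ≈ - C
    product≈-C′ = trans (*-comm _ _) product≈-C

    root₁-isRoot : root₁ * root₁ ≈ root₁ + C
    root₁-isRoot = vieta⇒root sum≈1 product≈-C

    root₂-isRoot : root₂ * root₂ ≈ root₂ + C
    root₂-isRoot = vieta⇒root sum≈1′ product≈-C′

    onlyRoots : ∀ {μ} → μ * μ ≈ μ + C → μ ≈ root₁ ⊎ μ ≈ root₂
    onlyRoots {μ} μ²≈μ+C = roots-of-product (begin
      (μ - root₁) * (μ - root₂)
        ≈⟨ solve 3 (λ μ a b → (μ :- a) :* (μ :- b) := μ :* μ :- μ :* (a :+ b) :+ a :* b) refl μ root₁ root₂ ⟩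
      μ * μ - μ * (root₁ + root₂) + root₁ * root₂
        ≈⟨ +-cong (+-cong μ²≈μ+C (-‿cong (*-congˡ sum≈1))) product≈-C ⟩
      μ + C - μ * 1# + - C
        ≈⟨ solve 2 (λ μ C → μ :+ C :- μ :* con (+ 1) :+ :- C := con (+ 0)) refl μ C ⟩
      0# ∎) distinct

  quadraticRoots : ∀ {C} → 0# ≤ C → QuadraticRoots C
  quadraticRoots {C} 0≤C = record
    { root₁      = r₁
    ; root₂      = r₂
    ; distinct   = r₁≉r₂
    ; sum≈1      = r₁+r₂≈1
    ; product≈-C = r₁r₂≈-C
    }
    where
    0≤4C : 0# ≤ (4 × 1# * C)
    0≤4C = *-nonneg (0≤n×1 4) 0≤C
    σ : Carrier
    σ = proj₁ (sqrt (1# + 4 × 1# * C) (0≤+ 0≤1 0≤4C))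
    σ²≈1+4C : σ * σ ≈ 1# + 4 × 1# * C
    σ²≈1+4C = proj₂ (sqrt (1# + 4 × 1# * C) (0≤+ 0≤1 0≤4C))
    ½ : Carrier
    ½ = proj₁ (inverse (2 × 1#) (1+n×1≉0 1))
    2½≈1 : 2 × 1# * ½ ≈ 1#
    2½≈1 = proj₂ (inverse (2 × 1#) (1+n×1≉0 1))
    r₁ r₂ : Carrier
    r₁ = (1# + σ) * ½
    r₂ = (1# - σ) * ½
    r₁+r₂≈1 : r₁ + r₂ ≈ 1#
    r₁+r₂≈1 = trans (solve 2 (λ σ h → (con (+ 1) :+ σ) :* h :+ (con (+ 1) :- σ) :* h := con (+ 2) :* h) refl σ ½) 2½≈1
    r₁r₂≈-C : r₁ * r₂ ≈ - C
    r₁r₂≈-C = begin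
      r₁ * r₂
        ≈⟨ solve 2 (λ σ h → (con (+ 1) :+ σ) :* h :* ((con (+ 1) :- σ) :* h)
                            := (con (+ 1) :- σ :* σ) :* (h :* h)) refl σ ½ ⟩
      (1# - σ * σ) * (½ * ½)
        ≈⟨ *-congʳ (+-congˡ (-‿cong σ²≈1+4C)) ⟩
      (1# - (1# + 4 × 1# * C)) * (½ * ½)
        ≈⟨ solve 2 (λ C h → (con (+ 1) :- (con (+ 1) :+ con (+ 4) :* C)) :* (h :* h)
                            := :- (C :* (con (+ 2) :* h :* (con (+ 2) :* h)))) refl C ½ ⟩
      - (C * (2 × 1# * ½ * (2 × 1# * ½)))
        ≈⟨ -‿cong (*-congˡ (*-cong 2½≈1 2½≈1)) ⟩
      - (C * (1# * 1#))
        ≈⟨ -‿cong (trans (*-congˡ (*-identityˡ 1#)) (*-identityʳ C)) ⟩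
      - C ∎
    r₁≉r₂ : ¬ (r₁ ≈ r₂)
    r₁≉r₂ r₁≈r₂ = 1+x≉0 0≤4C (begin
      1# + 4 × 1# * C
        ≈⟨ σ²≈1+4C ⟨
      σ * σ
        ≈⟨ solve 1 (λ σ → σ :* σ := σ :* σ :* (con (+ 1) :* con (+ 1))) refl σ ⟩
      σ * σ * (1# * 1#)
        ≈⟨ *-congˡ (*-cong 2½≈1 2½≈1) ⟨
      σ * σ * (2 × 1# * ½ * (2 × 1# * ½))
        ≈⟨ solve 2 (λ σ h → σ :* σ :* (con (+ 2) :* h :* (con (+ 2) :* h))
                            := ((con (+ 1) :+ σ) :* h :- (con (+ 1) :- σ) :* h)
                               :* ((con (+ 1) :+ σ) :* h :- (con (+ 1) :- σ) :* h)) refl σ ½ ⟩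
      (r₁ - r₂) * (r₁ - r₂)
        ≈⟨ *-congʳ (x≈y⇒x∙y⁻¹≈ε r₁≈r₂) ⟩
      0# * (r₁ - r₂)
        ≈⟨ zeroˡ _ ⟩
      0# ∎)

module ListSum {c ℓ} (R : CommutativeSemiring c ℓ) where
  open CommutativeSemiring R
  open import Algebra.Properties.CommutativeSemigroup +-commutativeSemigroup using (x∙yz≈y∙xz)
  open import Relation.Binary.Reasoning.Setoid setoid

  ∑ : ∀ {A : Set} → List A → (A → Carrier) → Carrier
  ∑ us f = foldr (λ u s → f u + s) 0# us

  ∑-cong : ∀ {A : Set} us {f g : A → Carrier} → (∀ u → f u ≈ g u) → ∑ us f ≈ ∑ us g
  ∑-cong []       f≈g = refl
  ∑-cong (u ∷ us) f≈g = +-cong (f≈g u) (∑-cong us f≈g)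

  ∑-zero : ∀ {A : Set} (us : List A) → ∑ us (λ _ → 0#) ≈ 0#
  ∑-zero []       = refl
  ∑-zero (u ∷ us) = trans (+-identityˡ _) (∑-zero us)

  ∑-distrib-+ : ∀ {A : Set} us (f g : A → Carrier) → ∑ us (λ u → f u + g u) ≈ ∑ us f + ∑ us g
  ∑-distrib-+ []       f g = sym (+-identityˡ 0#)
  ∑-distrib-+ (u ∷ us) f g = begin
    f u + g u + ∑ us (λ u → f u + g u)  ≈⟨ +-congˡ (∑-distrib-+ us f g) ⟩
    f u + g u + (∑ us f + ∑ us g)       ≈⟨ +-assoc _ _ _ ⟩
    f u + (g u + (∑ us f + ∑ us g))     ≈⟨ +-congˡ (x∙yz≈y∙xz _ _ _) ⟩
    f u + (∑ us f + (g u + ∑ us g))     ≈⟨ +-assoc _ _ _ ⟨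
    f u + ∑ us f + (g u + ∑ us g)       ∎

  *-distribˡ-∑ : ∀ {A : Set} us r (f : A → Carrier) → r * ∑ us f ≈ ∑ us (λ u → r * f u)
  *-distribˡ-∑ []       r f = zeroʳ r
  *-distribˡ-∑ (u ∷ us) r f = trans (distribˡ r _ _) (+-congˡ (*-distribˡ-∑ us r f))

  *-distribʳ-∑ : ∀ {A : Set} us r (f : A → Carrier) → ∑ us f * r ≈ ∑ us (λ u → f u * r)
  *-distribʳ-∑ us r f = trans (*-comm _ r) (trans (*-distribˡ-∑ us r f) (∑-cong us (λ u → *-comm r (f u))))

  ∑-comm : ∀ {A B : Set} us (vs : List B) (h : A → B → Carrier) →
           ∑ us (λ u → ∑ vs (h u)) ≈ ∑ vs (λ v → ∑ us (λ u → h u v))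
  ∑-comm []       vs h = sym (∑-zero vs)
  ∑-comm (u ∷ us) vs h = trans (+-congˡ (∑-comm us vs h)) (sym (∑-distrib-+ vs (h u) _))

  ∑-++ : ∀ {A : Set} us vs (f : A → Carrier) → ∑ (us ++ vs) f ≈ ∑ us f + ∑ vs f
  ∑-++ []       vs f = sym (+-identityˡ _)
  ∑-++ (u ∷ us) vs f = trans (+-congˡ (∑-++ us vs f)) (sym (+-assoc _ _ _))

  ∑-concatMap : ∀ {A B : Set} (blk : A → List B) us (f : B → Carrier) →
                ∑ (concatMap blk us) f ≈ ∑ us (λ u → ∑ (blk u) f)
  ∑-concatMap blk []       f = refl
  ∑-concatMap blk (u ∷ us) f = trans (∑-++ (blk u) _ f) (+-congˡ (∑-concatMap blk us f))

  ∑-map : ∀ {A B : Set} (g : A → B) us (f : B → Carrier) → ∑ (map g us) f ≡ ∑ us (f ∘ g)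
  ∑-map g []       f = ≡.refl
  ∑-map g (u ∷ us) f = ≡.cong (λ s → f (g u) + s) (∑-map g us f)

module ℕ-Sum = ListSum ℕ.+-*-commutativeSemiring
open ℕ-Sum using () renaming (∑ to ∑ℕ)

module Degrees (G : Multigraph) where
  open Multigraph G

  deg : V → ℕ
  deg u = ∑ℕ vertices (w u)

  deg₂ : V → ℕ
  deg₂ u = ∑ℕ vertices (λ v → w u v ℕ.* deg v)

  order : ℕ
  order = ∑ℕ vertices (λ _ → 1)

  degreeSum : ℕ
  degreeSum = ∑ℕ vertices deg

module MainEigenvalues {c ℓ ℓ≤} (F : RealClosedField c ℓ ℓ≤) (G : Multigraph) where
  open RealClosedField F
  open Multigraph G
  open Spectral F G
  open Degrees G
  open ℤ-Coefficients commRing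
  open OrderedField F
  open ListSum commutativeSemiring
  open import Data.Integer using (+_)
  open import Algebra.Properties.Semiring.Mult.TCOptimised semiring using (_×_; ×-homo-+; ×1-homo-*)
  open import Algebra.Properties.Ring ring using (-‿involutive; x∙y⁻¹≈ε⇒x≈y)
  open import Algebra.Properties.CommutativeSemigroup *-commutativeSemigroup using (x∙yz≈y∙xz)
  open import Relation.Binary.Reasoning.Setoid setoid

  fromℕ≈×1 : ∀ n → fromℕ n ≈ n × 1#
  fromℕ≈×1 zero    = refl
  fromℕ≈×1 (suc n) = trans (+-congˡ (fromℕ≈×1 n)) (sym (1+n×1 n))

  ∑-×1 : ∀ {A : Set} us (f : A → ℕ) → ∑ us (λ u → f u × 1#) ≈ ∑ℕ us f × 1#
  ∑-×1 []       f = refl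
  ∑-×1 (u ∷ us) f = trans (+-congˡ (∑-×1 us f)) (sym (×-homo-+ 1# (f u) _))

  d : V → Carrier
  d u = deg u × 1#

  adjMul-𝟙 : ∀ u → adjMul (λ _ → 1#) u ≈ d u
  adjMul-𝟙 u = trans (∑-cong vertices (λ v → trans (*-identityʳ _) (fromℕ≈×1 (w u v))))
                     (∑-×1 vertices (w u))

  adjMul-d : ∀ u → adjMul d u ≈ deg₂ u × 1#
  adjMul-d u = trans (∑-cong vertices (λ v → trans (*-congʳ (fromℕ≈×1 (w u v))) (sym (×1-homo-* (w u v) (deg v)))))
                     (∑-×1 vertices (λ v → w u v ℕ.* deg v))

  adjMul-shift : ∀ f r u → adjMul (λ v → f v - r) u ≈ adjMul f u - r * adjMul (λ _ → 1#) u
  adjMul-shift f r u = begin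
    ∑ vertices (λ v → W v * (f v - r))
      ≈⟨ ∑-cong vertices (λ v → solve 3 (λ w f r → w :* (f :- r) := w :* f :+ :- r :* (w :* con (+ 1)))
                                        refl (W v) (f v) r) ⟩
    ∑ vertices (λ v → W v * f v + - r * (W v * 1#))
      ≈⟨ ∑-distrib-+ vertices _ _ ⟩
    adjMul f u + ∑ vertices (λ v → - r * (W v * 1#))
      ≈⟨ +-congˡ (*-distribˡ-∑ vertices (- r) _) ⟨
    adjMul f u + - r * adjMul (λ _ → 1#) u
      ≈⟨ +-congˡ (solve 2 (λ r a → :- r :* a := :- (r :* a)) refl r _) ⟩
    adjMul f u - r * adjMul (λ _ → 1#) u ∎
    where
    W : V → Carrier
    W v = fromℕ (w u v)

  adjMul-selfAdjoint : (∀ u v → w u v ≡ w v u) →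
                       ∀ f g → ∑ vertices (λ u → f u * adjMul g u) ≈ ∑ vertices (λ u → adjMul f u * g u)
  adjMul-selfAdjoint w-sym f g = begin
    ∑ vertices (λ u → f u * ∑ vertices (λ v → W u v * g v))
      ≈⟨ ∑-cong vertices (λ u → *-distribˡ-∑ vertices (f u) _) ⟩
    ∑ vertices (λ u → ∑ vertices (λ v → f u * (W u v * g v)))
      ≈⟨ ∑-comm vertices vertices _ ⟩
    ∑ vertices (λ v → ∑ vertices (λ u → f u * (W u v * g v)))
      ≈⟨ ∑-cong vertices (λ v → ∑-cong vertices (rearrange v)) ⟩
    ∑ vertices (λ v → ∑ vertices (λ u → W v u * f u * g v))
      ≈⟨ ∑-cong vertices (λ v → *-distribʳ-∑ vertices (g v) _) ⟨
    ∑ vertices (λ v → adjMul f v * g v) ∎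
    where
    W : V → V → Carrier
    W u v = fromℕ (w u v)
    rearrange : ∀ v u → f u * (W u v * g v) ≈ W v u * f u * g v
    rearrange v u = begin
      f u * (W u v * g v)  ≈⟨ solve 3 (λ f w g → f :* (w :* g) := w :* f :* g) refl (f u) (W u v) (g v) ⟩
      W u v * f u * g v    ≡⟨ ≡.cong (λ n → fromℕ n * f u * g v) (w-sym u v) ⟩
      W v u * f u * g v    ∎

  module _ (w-sym : ∀ u v → w u v ≡ w v u) (C : ℕ) (2-walk-linear : ∀ u → deg₂ u ≡ deg u ℕ.+ C) where

    C′ : Carrier
    C′ = C × 1#

    adjMul-d≈d+C : ∀ u → adjMul d u ≈ d u + C′
    adjMul-d≈d+C u = trans (adjMul-d u) (trans (reflexive (≡.cong (_× 1#) (2-walk-linear u))) (×-homo-+ 1# (deg u) C))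

    shiftedDegree-eigenvector : ∀ {a b} → a + b ≈ 1# → a * b ≈ - C′ →
                                ∀ u → adjMul (λ v → d v - b) u ≈ a * (d u - b)
    shiftedDegree-eigenvector {a} {b} a+b≈1 ab≈-C u = begin
      adjMul (λ v → d v - b) u
        ≈⟨ adjMul-shift d b u ⟩
      adjMul d u - b * adjMul (λ _ → 1#) u
        ≈⟨ +-cong (adjMul-d≈d+C u) (-‿cong (*-congˡ (adjMul-𝟙 u))) ⟩
      d u + C′ - b * d u
        ≈⟨ +-congʳ (+-cong (trans (sym (*-identityˡ _)) (*-congʳ (sym a+b≈1)))
                           (trans (sym (-‿involutive _)) (-‿cong (sym ab≈-C)))) ⟩
      (a + b) * d u + - (a * b) - b * d u
        ≈⟨ solve 3 (λ a b d → (a :+ b) :* d :+ :- (a :* b) :- b :* d := a :* (d :- b)) refl a b (d u) ⟩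
      a * (d u - b) ∎

    shiftedDegree-sum : ∀ b → ∑ vertices (λ v → d v - b) ≈ degreeSum × 1# - b * order × 1#
    shiftedDegree-sum b = begin
      ∑ vertices (λ v → d v - b)
        ≈⟨ ∑-cong vertices (λ v → solve 2 (λ d b → d :- b := d :+ :- b :* con (+ 1)) refl (d v) b) ⟩
      ∑ vertices (λ v → d v + - b * 1#)
        ≈⟨ ∑-distrib-+ vertices d _ ⟩
      ∑ vertices d + ∑ vertices (λ v → - b * 1#)
        ≈⟨ +-congˡ (*-distribˡ-∑ vertices (- b) _) ⟨
      ∑ vertices d + - b * ∑ vertices (λ v → 1#)
        ≈⟨ +-cong (∑-×1 vertices deg) (*-congˡ (∑-×1 vertices (λ _ → 1))) ⟩
      degreeSum × 1# + - b * order × 1#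
        ≈⟨ +-congˡ (solve 2 (λ b n → :- b :* n := :- (b :* n)) refl b _) ⟩
      degreeSum × 1# - b * order × 1# ∎

    shiftedDegree-main : ∀ {b} → b * b ≈ b + C′ →
                         degreeSum ℕ.* degreeSum ≢ degreeSum ℕ.* order ℕ.+ C ℕ.* (order ℕ.* order) →
                         ¬ (∑ vertices (λ v → d v - b) ≈ 0#)
    shiftedDegree-main {b} b²≈b+C S²≢SN+CN² ∑≈0 = S²≢SN+CN² (×1-injective (begin
      (S ℕ.* S) × 1#
        ≈⟨ ×1-homo-* S S ⟩
      S′ * S′
        ≈⟨ *-cong S′≈bN′ S′≈bN′ ⟩
      b * N′ * (b * N′)
        ≈⟨ solve 2 (λ b n → b :* n :* (b :* n) := b :* b :* (n :* n)) refl b N′ ⟩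
      b * b * (N′ * N′)
        ≈⟨ *-congʳ b²≈b+C ⟩
      (b + C′) * (N′ * N′)
        ≈⟨ solve 3 (λ b c n → (b :+ c) :* (n :* n) := b :* n :* n :+ c :* (n :* n)) refl b C′ N′ ⟩
      b * N′ * N′ + C′ * (N′ * N′)
        ≈⟨ +-congʳ (*-congʳ S′≈bN′) ⟨
      S′ * N′ + C′ * (N′ * N′)
        ≈⟨ +-cong (×1-homo-* S N) (trans (×1-homo-* C _) (*-congˡ (×1-homo-* N N))) ⟨
      (S ℕ.* N) × 1# + (C ℕ.* (N ℕ.* N)) × 1#
        ≈⟨ ×-homo-+ 1# (S ℕ.* N) _ ⟨
      (S ℕ.* N ℕ.+ C ℕ.* (N ℕ.* N)) × 1# ∎))
      where
      S = degreeSum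
      N = order
      S′ = S × 1#
      N′ = N × 1#
      S′≈bN′ : S′ ≈ b * N′
      S′≈bN′ = x∙y⁻¹≈ε⇒x≈y S′ (b * N′) (trans (sym (shiftedDegree-sum b)) ∑≈0)

    mainEigenvalue⇒root : ∀ {μ} → IsMainEigenvalue μ → μ * μ ≈ μ + C′
    mainEigenvalue⇒root {μ} (v , Av≈μv , s₀≉0) = x∙y⁻¹≈ε⇒x≈y (μ * μ) (μ + C′) (*-cancelʳ-≉0 (begin
      (μ * μ - (μ + C′)) * s₀
        ≈⟨ solve 3 (λ μ c s → (μ :* μ :- (μ :+ c)) :* s := μ :* (μ :* s) :- μ :* s :- c :* s) refl μ C′ s₀ ⟩
      μ * (μ * s₀) - μ * s₀ - C′ * s₀
        ≈⟨ +-congʳ (+-cong (*-congˡ μs₀≈s₁) (-‿cong μs₀≈s₁)) ⟩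
      μ * s₁ - s₁ - C′ * s₀
        ≈⟨ +-congʳ (+-congʳ μs₁≈s₁+Cs₀) ⟩
      s₁ + C′ * s₀ - s₁ - C′ * s₀
        ≈⟨ solve 2 (λ a b → a :+ b :- a :- b := con (+ 0)) refl s₁ (C′ * s₀) ⟩
      0# ∎) s₀≉0)
      where
      s₀ = ∑ vertices v
      s₁ = ∑ vertices (λ u → d u * v u)
      μs₀≈s₁ : μ * s₀ ≈ s₁
      μs₀≈s₁ = begin
        μ * s₀                                        ≈⟨ *-distribˡ-∑ vertices μ v ⟩
        ∑ vertices (λ u → μ * v u)                    ≈⟨ ∑-cong vertices (λ u → trans (sym (Av≈μv u))
                                                                                     (sym (*-identityˡ _))) ⟩
        ∑ vertices (λ u → 1# * adjMul v u)            ≈⟨ adjMul-selfAdjoint w-sym (λ _ → 1#) v ⟩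
        ∑ vertices (λ u → adjMul (λ _ → 1#) u * v u)  ≈⟨ ∑-cong vertices (λ u → *-congʳ (adjMul-𝟙 u)) ⟩
        s₁                                            ∎
      μs₁≈s₁+Cs₀ : μ * s₁ ≈ s₁ + C′ * s₀
      μs₁≈s₁+Cs₀ = begin
        μ * s₁                                   ≈⟨ *-distribˡ-∑ vertices μ _ ⟩
        ∑ vertices (λ u → μ * (d u * v u))       ≈⟨ ∑-cong vertices (λ u → trans (x∙yz≈y∙xz μ (d u) (v u))
                                                                                  (*-congˡ (sym (Av≈μv u)))) ⟩
        ∑ vertices (λ u → d u * adjMul v u)      ≈⟨ adjMul-selfAdjoint w-sym d v ⟩
        ∑ vertices (λ u → adjMul d u * v u)      ≈⟨ ∑-cong vertices (λ u → trans (*-congʳ (adjMul-d≈d+C u))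
                                                                                  (distribʳ _ _ _)) ⟩
        ∑ vertices (λ u → d u * v u + C′ * v u)  ≈⟨ ∑-distrib-+ vertices _ _ ⟩
        s₁ + ∑ vertices (λ u → C′ * v u)         ≈⟨ +-congˡ (*-distribˡ-∑ vertices C′ v) ⟨
        s₁ + C′ * s₀                             ∎

    exactlyTwoMainEigenvalues : degreeSum ℕ.* degreeSum ≢ degreeSum ℕ.* order ℕ.+ C ℕ.* (order ℕ.* order) →
                                ExactlyTwoMainEigenvalues
    exactlyTwoMainEigenvalues S²≢SN+CN² =
      root₁ , root₂ , distinct ,
      isMain sum≈1  product≈-C  root₂-isRoot ,
      isMain sum≈1′ product≈-C′ root₁-isRoot ,
      λ μ → onlyRoots ∘ mainEigenvalue⇒root
      where
      open QuadraticRoots (quadraticRoots (0≤n×1 C))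
      isMain : ∀ {a b} → a + b ≈ 1# → a * b ≈ - C′ → b * b ≈ b + C′ → IsMainEigenvalue a
      isMain a+b≈1 ab≈-C b²≈b+C =
        (λ v → d v - _) , shiftedDegree-eigenvector a+b≈1 ab≈-C , shiftedDegree-main b²≈b+C S²≢SN+CN²

open import Data.Nat using (_+_; _*_; _∸_; _<_; _≡ᵇ_)
open ≡ using (refl; cong; cong₂; trans; sym)
open import Algebra.Properties.Semiring.Sum ℕ.+-*-semiring
  using (sum; sum-syntax; sum-cong-≗; ∑-distrib-+; sum-replicate-zero; *-distribˡ-sum; *-distribʳ-sum)

∑-const : ∀ n c → ∑[ j < n ] c ≡ n * c
∑-const zero    c = refl
∑-const (suc n) c = cong (c +_) (∑-const n c)

∑-constant : ∀ {n} {f : Fin n → ℕ} {c} → (∀ j → f j ≡ c) → sum f ≡ n * c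
∑-constant {n} {c = c} f≗c = trans (sum-cong-≗ f≗c) (∑-const n c)

∑-factorʳ : ∀ {n} {f g : Fin n → ℕ} {c} → (∀ j → f j ≡ g j * c) → sum f ≡ sum g * c
∑-factorʳ {g = g} {c} f≗gc = trans (sum-cong-≗ f≗gc) (sym (*-distribʳ-sum c g))

∑-identityʳ : ∀ {n} (f : Fin n → ℕ) → ∑[ j < n ] (f j + 0) ≡ sum f
∑-identityʳ f = sum-cong-≗ (λ j → ℕ.+-identityʳ (f j))

∑∑-inner-const : ∀ {n} m (f : Fin n → ℕ) → ∑[ j < n ] ∑[ l < m ] f j ≡ m * sum f
∑∑-inner-const m f = trans (sum-cong-≗ (λ j → ∑-const m (f j))) (sym (*-distribˡ-sum m f))

∑-ifB-cong : ∀ {n} (b b′ : Fin n → Bool) v → (∀ j → b j ≡ b′ j) →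
             ∑[ j < n ] ifB (b j) v ≡ ∑[ j < n ] ifB (b′ j) v
∑-ifB-cong b b′ v b≗b′ = sum-cong-≗ (λ j → cong (λ c → ifB c v) (b≗b′ j))

∑-pointMass : ∀ {n m} → m < n → ∀ v → ∑[ j < n ] ifB (m ≡ᵇ toℕ j) v ≡ v
∑-pointMass {suc n} {zero}  _         v = trans (cong (v +_) (sum-replicate-zero n)) (ℕ.+-identityʳ v)
∑-pointMass {suc n} {suc m} (s≤s m<n) v = ∑-pointMass m<n v

∑-pointMass′ : ∀ {n m} → m < n → ∀ v → ∑[ j < n ] ifB (toℕ j ≡ᵇ m) v ≡ v
∑-pointMass′ {suc n} {zero}  _         v = trans (cong (v +_) (sum-replicate-zero n)) (ℕ.+-identityʳ v)
∑-pointMass′ {suc n} {suc m} (s≤s m<n) v = ∑-pointMass′ m<n v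

∑-eqF : ∀ {n} (i : Fin n) v → ∑[ j < n ] ifB (eqF i j) v ≡ v
∑-eqF i = ∑-pointMass (toℕ<n i)

∑-eqF′ : ∀ {n} (i : Fin n) v → ∑[ j < n ] ifB (eqF j i) v ≡ v
∑-eqF′ i = ∑-pointMass′ (toℕ<n i)

∑∑-eqF : ∀ {n} m (i : Fin n) v → ∑[ j < n ] ∑[ l < m ] (ifB (eqF i j) v + 0) ≡ m * v
∑∑-eqF m i v = trans (∑∑-inner-const m (λ j → ifB (eqF i j) v + 0))
                     (cong (m *_) (trans (∑-identityʳ (λ j → ifB (eqF i j) v)) (∑-eqF i v)))

<⇒≡ᵇ-false : ∀ {m n} → m < n → (n ≡ᵇ m) ≡ false
<⇒≡ᵇ-false {zero}  {suc n} _         = refl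
<⇒≡ᵇ-false {suc m} {suc n} (s≤s m<n) = <⇒≡ᵇ-false m<n

∑-next : ∀ {n} (i : Fin n) v → ∑[ j < n ] ifB (isNext i j) v ≡ v
∑-next {n} i v with suc (toℕ i) ≡ᵇ n in i+1≡ᵇn
... | false = trans (∑-ifB-cong {n} (λ j → (suc (toℕ i) ≡ᵇ toℕ j) ∨ false) (λ j → suc (toℕ i) ≡ᵇ toℕ j) v
                                (λ j → Bool.∨-identityʳ _))
                    (∑-pointMass {n} {suc (toℕ i)} (ℕ.≤∧≢⇒< (toℕ<n i) i+1≢n) v)
  where
  i+1≢n : suc (toℕ i) ≢ n
  i+1≢n i+1≡n = ≡.subst T i+1≡ᵇn (ℕ.≡⇒≡ᵇ (suc (toℕ i)) n i+1≡n)
... | true  = trans (∑-ifB-cong {n} (λ j → (suc (toℕ i) ≡ᵇ toℕ j) ∨ (toℕ j ≡ᵇ 0)) (λ j → toℕ j ≡ᵇ 0) v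
                                (λ j → cong (_∨ (toℕ j ≡ᵇ 0)) (i+1≢j j)))
                    (∑-pointMass′ {n} {0} (ℕ.<-≤-trans (s≤s z≤n) (toℕ<n i)) v)
  where
  i+1≡n : suc (toℕ i) ≡ n
  i+1≡n = ℕ.≡ᵇ⇒≡ (suc (toℕ i)) n (≡.subst T (sym i+1≡ᵇn) _)
  i+1≢j : ∀ (j : Fin n) → (suc (toℕ i) ≡ᵇ toℕ j) ≡ false
  i+1≢j j = ≡.subst (λ m → (m ≡ᵇ toℕ j) ≡ false) (sym i+1≡n) (<⇒≡ᵇ-false (toℕ<n j))

∑-prev : ∀ {n} (i : Fin n) v → ∑[ j < n ] ifB (isNext j i) v ≡ v
∑-prev {suc n} fzero    v = trans (∑-ifB-cong (λ j → isNext j fzero) (λ j → toℕ j ≡ᵇ n) v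
                                              (λ j → Bool.∧-identityʳ _))
                                  (∑-pointMass′ (ℕ.n<1+n n) v)
∑-prev {suc n} (fsuc i) v = trans (∑-ifB-cong (λ j → isNext j (fsuc i)) (λ j → toℕ j ≡ᵇ toℕ i) v isNext-j-[1+i])
                                  (∑-pointMass′ (ℕ.<-trans (toℕ<n i) (ℕ.n<1+n n)) v)
  where
  isNext-j-[1+i] : ∀ j → isNext j (fsuc i) ≡ (toℕ j ≡ᵇ toℕ i)
  isNext-j-[1+i] j = trans (cong ((toℕ j ≡ᵇ toℕ i) ∨_) (Bool.∧-zeroʳ _)) (Bool.∨-identityʳ _)

open ℕ-Sum using (∑-map; ∑-++; ∑-concatMap)

∑ℕ-tabulate : ∀ {A : Set} n (g : Fin n → A) f → ∑ℕ (tabulate g) f ≡ ∑[ i < n ] f (g i)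
∑ℕ-tabulate zero    g f = refl
∑ℕ-tabulate (suc n) g f = cong (f (g fzero) +_) (∑ℕ-tabulate n (g ∘ fsuc) f)

∑ℕ-map-allFin : ∀ {A : Set} n (g : Fin n → A) f → ∑ℕ (map g (allFin n)) f ≡ ∑[ i < n ] f (g i)
∑ℕ-map-allFin n g f = trans (∑-map g (allFin n) f) (∑ℕ-tabulate n (λ i → i) (f ∘ g))

data Cell : Set where
  X Y Z P Q : Cell

∑ᶜ : (Cell → ℕ) → ℕ
∑ᶜ h = h X + (h Y + (h Z + (h P + h Q)))

∑ᶜ-cong : ∀ {g h : Cell → ℕ} → (∀ c → g c ≡ h c) → ∑ᶜ g ≡ ∑ᶜ h
∑ᶜ-cong g≗h = cong₂ _+_ (g≗h X) (cong₂ _+_ (g≗h Y) (cong₂ _+_ (g≗h Z) (cong₂ _+_ (g≗h P) (g≗h Q))))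

module FivePartGraph {V : Set} {t a b : ℕ}
                     (x′ y′ z′ : Fin t → V) (p′ : Fin t → Fin a → V) (q′ : Fin t → Fin b → V) where

  -- This is the enumeration used by H² and H³ in Defs, so that `graph` below is H² k t,
  -- resp. H³ k t, up to definitional equality.
  block : Fin t → List V
  block i = x′ i ∷ y′ i ∷ z′ i ∷ (map (p′ i) (allFin a) ++ map (q′ i) (allFin b))

  vertexList : List V
  vertexList = concatMap block (allFin t)

  cellSum : Cell → (V → ℕ) → ℕ
  cellSum X f = ∑[ i < t ] f (x′ i)
  cellSum Y f = ∑[ i < t ] f (y′ i)
  cellSum Z f = ∑[ i < t ] f (z′ i)
  cellSum P f = ∑[ i < t ] ∑[ l < a ] f (p′ i l)
  cellSum Q f = ∑[ i < t ] ∑[ l < b ] f (q′ i l)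

  cellSum-zero : ∀ c → cellSum c (λ _ → 0) ≡ 0
  cellSum-zero X = sum-replicate-zero t
  cellSum-zero Y = sum-replicate-zero t
  cellSum-zero Z = sum-replicate-zero t
  cellSum-zero P = trans (∑-constant {t} (λ _ → sum-replicate-zero a)) (ℕ.*-zeroʳ t)
  cellSum-zero Q = trans (∑-constant {t} (λ _ → sum-replicate-zero b)) (ℕ.*-zeroʳ t)

  cellSize : Cell → ℕ
  cellSize P = t * a
  cellSize Q = t * b
  cellSize _ = t

  ∑-vertexList : ∀ f → ∑ℕ vertexList f ≡ ∑ᶜ (λ c → cellSum c f)
  ∑-vertexList f = begin
    ∑ℕ (concatMap block (allFin t)) f                       ≡⟨ ∑-concatMap block (allFin t) f ⟩
    ∑ℕ (allFin t) (λ i → ∑ℕ (block i) f)                    ≡⟨ ∑ℕ-tabulate t (λ i → i) _ ⟩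
    ∑[ i < t ] ∑ℕ (block i) f                               ≡⟨ sum-cong-≗ block-sum ⟩
    ∑[ i < t ] (fx i + (fy i + (fz i + (fp i + fq i))))       ≡⟨ ∑-distrib-+ fx _ ⟩
    sum fx + ∑[ i < t ] (fy i + (fz i + (fp i + fq i)))       ≡⟨ cong (sum fx +_) (∑-distrib-+ fy _) ⟩
    sum fx + (sum fy + ∑[ i < t ] (fz i + (fp i + fq i)))     ≡⟨ cong (λ s → sum fx + (sum fy + s)) (∑-distrib-+ fz _) ⟩
    sum fx + (sum fy + (sum fz + ∑[ i < t ] (fp i + fq i)))   ≡⟨ cong (λ s → sum fx + (sum fy + (sum fz + s)))
                                                                     (∑-distrib-+ fp fq) ⟩
    ∑ᶜ (λ c → cellSum c f)                                  ∎
    where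
    open ≡.≡-Reasoning
    fx fy fz fp fq : Fin t → ℕ
    fx i = f (x′ i)
    fy i = f (y′ i)
    fz i = f (z′ i)
    fp i = ∑[ l < a ] f (p′ i l)
    fq i = ∑[ l < b ] f (q′ i l)
    block-sum : ∀ i → ∑ℕ (block i) f ≡ fx i + (fy i + (fz i + (fp i + fq i)))
    block-sum i = cong (λ s → fx i + (fy i + (fz i + s)))
      (trans (∑-++ (map (p′ i) (allFin a)) _ f) (cong₂ _+_ (∑ℕ-map-allFin a (p′ i) f) (∑ℕ-map-allFin b (q′ i) f)))

  record CellConstant {A : Set} (g : V → A) (G : Cell → A) : Set where
    field
      on-x : ∀ i → g (x′ i) ≡ G X
      on-y : ∀ i → g (y′ i) ≡ G Y
      on-z : ∀ i → g (z′ i) ≡ G Z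
      on-p : ∀ i l → g (p′ i l) ≡ G P
      on-q : ∀ i l → g (q′ i l) ≡ G Q

  const-cellConstant : ∀ {A : Set} (n : A) → CellConstant (λ _ → n) (λ _ → n)
  const-cellConstant n = record
    { on-x = λ _ → refl ; on-y = λ _ → refl ; on-z = λ _ → refl ; on-p = λ _ _ → refl ; on-q = λ _ _ → refl }

  map-cellConstant : ∀ {A B : Set} {g : V → A} {G : Cell → A} {f : V → B} (h : A → B) →
                     CellConstant g G → (∀ v → f v ≡ h (g v)) → CellConstant f (h ∘ G)
  map-cellConstant h g-const f≗h∘g = record
    { on-x = λ i → trans (f≗h∘g _) (cong h (on-x i))
    ; on-y = λ i → trans (f≗h∘g _) (cong h (on-y i))
    ; on-z = λ i → trans (f≗h∘g _) (cong h (on-z i))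
    ; on-p = λ i l → trans (f≗h∘g _) (cong h (on-p i l))
    ; on-q = λ i l → trans (f≗h∘g _) (cong h (on-q i l))
    }
    where open CellConstant g-const

  module _ {g : V → ℕ} {G : Cell → ℕ} (g-const : CellConstant g G) where
    open CellConstant g-const

    cellSum-weighted : ∀ c f → cellSum c (λ v → f v * g v) ≡ cellSum c f * G c
    cellSum-weighted X f = ∑-factorʳ (λ i → cong (f (x′ i) *_) (on-x i))
    cellSum-weighted Y f = ∑-factorʳ (λ i → cong (f (y′ i) *_) (on-y i))
    cellSum-weighted Z f = ∑-factorʳ (λ i → cong (f (z′ i) *_) (on-z i))
    cellSum-weighted P f = ∑-factorʳ (λ i → ∑-factorʳ (λ l → cong (f (p′ i l) *_) (on-p i l)))
    cellSum-weighted Q f = ∑-factorʳ (λ i → ∑-factorʳ (λ l → cong (f (q′ i l) *_) (on-q i l)))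

    cellSum-constant : ∀ c → cellSum c g ≡ cellSize c * G c
    cellSum-constant X = ∑-constant on-x
    cellSum-constant Y = ∑-constant on-y
    cellSum-constant Z = ∑-constant on-z
    cellSum-constant P = trans (∑-constant (λ i → ∑-constant (on-p i))) (sym (ℕ.*-assoc t a (G P)))
    cellSum-constant Q = trans (∑-constant (λ i → ∑-constant (on-q i))) (sym (ℕ.*-assoc t b (G Q)))

  module Equitable (w : V → V → ℕ) (cell : V → Cell) (cell-constant : CellConstant cell (λ c → c))
                   (B : Cell → Cell → ℕ) (equitable : ∀ u c → cellSum c (w u) ≡ B (cell u) c)
                   (D : Cell → ℕ) (row-sums : ∀ c → ∑ᶜ (B c) ≡ D c) where

    graph : Multigraph
    graph = record { V = V ; vertices = vertexList ; w = w }

    open Degrees graph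

    deg≡D : ∀ u → deg u ≡ D (cell u)
    deg≡D u = trans (∑-vertexList (w u)) (trans (∑ᶜ-cong (equitable u)) (row-sums (cell u)))

    deg-cellConstant : CellConstant deg D
    deg-cellConstant = map-cellConstant D cell-constant deg≡D

    2-walk-linear : ∀ C → (∀ c → ∑ᶜ (λ c′ → B c c′ * D c′) ≡ D c + C) → ∀ u → deg₂ u ≡ deg u + C
    2-walk-linear C quotient-linear u = begin
      deg₂ u                                      ≡⟨ ∑-vertexList _ ⟩
      ∑ᶜ (λ c → cellSum c (λ v → w u v * deg v))  ≡⟨ ∑ᶜ-cong (λ c → cellSum-weighted deg-cellConstant c (w u)) ⟩
      ∑ᶜ (λ c → cellSum c (w u) * D c)            ≡⟨ ∑ᶜ-cong (λ c → cong (_* D c) (equitable u c)) ⟩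
      ∑ᶜ (λ c → B (cell u) c * D c)               ≡⟨ quotient-linear (cell u) ⟩
      D (cell u) + C                              ≡⟨ cong (_+ C) (deg≡D u) ⟨
      deg u + C                                   ∎
      where open ≡.≡-Reasoning

    order≡ : order ≡ ∑ᶜ (λ c → cellSize c * 1)
    order≡ = trans (∑-vertexList _) (∑ᶜ-cong (cellSum-constant (const-cellConstant 1)))

    degreeSum≡ : degreeSum ≡ ∑ᶜ (λ c → cellSize c * D c)
    degreeSum≡ = trans (∑-vertexList _) (∑ᶜ-cong (cellSum-constant deg-cellConstant))

    exactlyTwoMainEigenvalues :
      ∀ {r ℓ ℓ≤} (F : RealClosedField r ℓ ℓ≤) C → (∀ u v → w u v ≡ w v u) →
      (∀ c → ∑ᶜ (λ c′ → B c c′ * D c′) ≡ D c + C) →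
      (let S = ∑ᶜ (λ c → cellSize c * D c)
           N = ∑ᶜ (λ c → cellSize c * 1)
       in S * S ≢ S * N + C * (N * N)) →
      Spectral.ExactlyTwoMainEigenvalues F graph
    exactlyTwoMainEigenvalues F C w-sym quotient-linear S²≢SN+CN² =
      MainEigenvalues.exactlyTwoMainEigenvalues F graph w-sym C (2-walk-linear C quotient-linear)
        (≡.subst₂ (λ S N → S * S ≢ S * N + C * (N * N)) (sym degreeSum≡) (sym order≡) S²≢SN+CN²)

module H²-Partition (k t : ℕ) where
  open FivePartGraph {V² k t} {t} {k} {k ∸ 1} x y z p q public

  cell² : V² k t → Cell
  cell² (x _)   = X
  cell² (y _)   = Y
  cell² (z _)   = Z
  cell² (p _ _) = P
  cell² (q _ _) = Q

  cell²-constant : CellConstant cell² (λ c → c)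
  cell²-constant = record
    { on-x = λ _ → refl ; on-y = λ _ → refl ; on-z = λ _ → refl ; on-p = λ _ _ → refl ; on-q = λ _ _ → refl }

  B² : Cell → Cell → ℕ
  B² X Y = 2
  B² Y X = 2
  B² Y Z = 1
  B² Y Q = (k ∸ 1) * 2
  B² Z Y = 1
  B² Z P = k * 2
  B² P Z = 2
  B² Q Y = 2
  B² _ _ = 0

  -- Since w u v = e² u v + e² v u, a cell that e² reaches from u in only one orientation
  -- contributes summands of the form ifB … + 0.
  equitable : ∀ u c → cellSum c (Multigraph.w (H² k t) u) ≡ B² (cell² u) c
  equitable (x i)   X = cellSum-zero X
  equitable (x i)   Y = trans (∑-distrib-+ (λ j → ifB (eqF i j) 1) (λ j → ifB (isNext j i) 1))
                              (cong₂ _+_ (∑-eqF i 1) (∑-prev i 1))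
  equitable (x i)   Z = cellSum-zero Z
  equitable (x i)   P = cellSum-zero P
  equitable (x i)   Q = cellSum-zero Q
  equitable (y i)   X = trans (∑-distrib-+ (λ j → ifB (isNext i j) 1) (λ j → ifB (eqF j i) 1))
                              (cong₂ _+_ (∑-next i 1) (∑-eqF′ i 1))
  equitable (y i)   Y = cellSum-zero Y
  equitable (y i)   Z = trans (∑-identityʳ (λ j → ifB (eqF i j) 1)) (∑-eqF i 1)
  equitable (y i)   P = cellSum-zero P
  equitable (y i)   Q = ∑∑-eqF (k ∸ 1) i 2
  equitable (z i)   X = cellSum-zero X
  equitable (z i)   Y = ∑-eqF′ i 1
  equitable (z i)   Z = cellSum-zero Z
  equitable (z i)   P = ∑∑-eqF k i 2
  equitable (z i)   Q = cellSum-zero Q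
  equitable (p i l) X = cellSum-zero X
  equitable (p i l) Y = cellSum-zero Y
  equitable (p i l) Z = ∑-eqF′ i 2
  equitable (p i l) P = cellSum-zero P
  equitable (p i l) Q = cellSum-zero Q
  equitable (q i l) X = cellSum-zero X
  equitable (q i l) Y = ∑-eqF′ i 2
  equitable (q i l) Z = cellSum-zero Z
  equitable (q i l) P = cellSum-zero P
  equitable (q i l) Q = cellSum-zero Q

module H²-Quotient (m t₀ : ℕ) where
  open H²-Partition (suc m) (suc t₀)

  D² : Cell → ℕ
  D² X = 2
  D² Y = 3 + m * 2
  D² Z = 3 + m * 2
  D² P = 2
  D² Q = 2

  row-sums : ∀ c → ∑ᶜ (B² c) ≡ D² c
  row-sums X = refl
  row-sums Y = refl
  row-sums Z = cong (3 +_) (ℕ.+-identityʳ (m * 2))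
  row-sums P = refl
  row-sums Q = refl

  -- The left-hand sides are ∑ᶜ (λ c′ → B² c c′ * D² c′) unfolded; a trailing + 0 is a zero
  -- entry of B² that does not reduce away, as _+_ recurses on its left argument.
  twice-D-Y : ∀ m → 2 * (3 + m * 2) + 0 ≡ 2 + 4 * suc m
  twice-D-Y = solve-∀

  quotient-linear : ∀ c → ∑ᶜ (λ c′ → B² c c′ * D² c′) ≡ D² c + 4 * suc m
  quotient-linear X = twice-D-Y m
  quotient-linear Y = row-Y m
    where
    row-Y : ∀ m → 2 * 2 + (1 * (3 + m * 2) + m * 2 * 2) ≡ 3 + m * 2 + 4 * suc m
    row-Y = solve-∀
  quotient-linear Z = row-Z m
    where
    row-Z : ∀ m → 1 * (3 + m * 2) + (suc m * 2 * 2 + 0) ≡ 3 + m * 2 + 4 * suc m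
    row-Z = solve-∀
  quotient-linear P = twice-D-Y m
  quotient-linear Q = twice-D-Y m

  S N : ℕ
  S = ∑ᶜ (λ c → cellSize c * D² c)
  N = ∑ᶜ (λ c → cellSize c * 1)

  S²<SN+CN² : S * S < S * N + 4 * suc m * (N * N)
  S²<SN+CN² = ≡.subst (S * S <_) (sym (excess t₀ m)) (ℕ.m<m+n (S * S) {E} (s≤s z≤n))
    where
    E = suc t₀ * suc t₀ * (4 * (suc m * (suc (m * 2) * suc (m * 2))))
    excess : ∀ t₀ m →
      let t = suc t₀
          S = t * 2 + (t * (3 + m * 2) + (t * (3 + m * 2) + (t * suc m * 2 + t * m * 2)))
          N = t * 1 + (t * 1 + (t * 1 + (t * suc m * 1 + t * m * 1)))
      in S * N + 4 * suc m * (N * N) ≡ S * S + t * t * (4 * (suc m * (suc (m * 2) * suc (m * 2))))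
    excess = solve-∀

module H³-Partition (k t : ℕ) where
  open FivePartGraph {V³ k t} {t} {k} {k} x y z p q public

  cell³ : V³ k t → Cell
  cell³ (x _)   = X
  cell³ (y _)   = Y
  cell³ (z _)   = Z
  cell³ (p _ _) = P
  cell³ (q _ _) = Q

  cell³-constant : CellConstant cell³ (λ c → c)
  cell³-constant = record
    { on-x = λ _ → refl ; on-y = λ _ → refl ; on-z = λ _ → refl ; on-p = λ _ _ → refl ; on-q = λ _ _ → refl }

  B³ : Cell → Cell → ℕ
  B³ X Y = 1
  B³ X Z = 1
  B³ Y X = 1
  B³ Y Z = 1
  B³ Y P = k * 2
  B³ Z X = 1
  B³ Z Y = 1
  B³ Z Q = k * 2
  B³ P Y = 2
  B³ Q Z = 2
  B³ _ _ = 0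

  equitable : ∀ u c → cellSum c (Multigraph.w (H³ k t) u) ≡ B³ (cell³ u) c
  equitable (x i)   X = cellSum-zero X
  equitable (x i)   Y = trans (∑-identityʳ (λ j → ifB (eqF i j) 1)) (∑-eqF i 1)
  equitable (x i)   Z = ∑-prev i 1
  equitable (x i)   P = cellSum-zero P
  equitable (x i)   Q = cellSum-zero Q
  equitable (y i)   X = ∑-eqF′ i 1
  equitable (y i)   Y = cellSum-zero Y
  equitable (y i)   Z = trans (∑-identityʳ (λ j → ifB (eqF i j) 1)) (∑-eqF i 1)
  equitable (y i)   P = ∑∑-eqF k i 2
  equitable (y i)   Q = cellSum-zero Q
  equitable (z i)   X = trans (∑-identityʳ (λ j → ifB (isNext i j) 1)) (∑-next i 1)
  equitable (z i)   Y = ∑-eqF′ i 1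
  equitable (z i)   Z = cellSum-zero Z
  equitable (z i)   P = cellSum-zero P
  equitable (z i)   Q = ∑∑-eqF k i 2
  equitable (p i l) X = cellSum-zero X
  equitable (p i l) Y = ∑-eqF′ i 2
  equitable (p i l) Z = cellSum-zero Z
  equitable (p i l) P = cellSum-zero P
  equitable (p i l) Q = cellSum-zero Q
  equitable (q i l) X = cellSum-zero X
  equitable (q i l) Y = cellSum-zero Y
  equitable (q i l) Z = ∑-eqF′ i 2
  equitable (q i l) P = cellSum-zero P
  equitable (q i l) Q = cellSum-zero Q

module H³-Quotient (m t₀ : ℕ) where
  open H³-Partition (suc m) (suc t₀)

  D³ : Cell → ℕ
  D³ X = 2
  D³ Y = 4 + m * 2
  D³ Z = 4 + m * 2
  D³ P = 2
  D³ Q = 2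

  row-sums : ∀ c → ∑ᶜ (B³ c) ≡ D³ c
  row-sums X = refl
  row-sums Y = cong (4 +_) (ℕ.+-identityʳ (m * 2))
  row-sums Z = refl
  row-sums P = refl
  row-sums Q = refl

  twice-D-Y : ∀ m → 2 * (4 + m * 2) + 0 ≡ 2 + (4 * suc m + 2)
  twice-D-Y = solve-∀

  quotient-linear : ∀ c → ∑ᶜ (λ c′ → B³ c c′ * D³ c′) ≡ D³ c + (4 * suc m + 2)
  quotient-linear X = row-X m
    where
    row-X : ∀ m → 1 * (4 + m * 2) + (1 * (4 + m * 2) + 0) ≡ 2 + (4 * suc m + 2)
    row-X = solve-∀
  quotient-linear Y = row-Y m
    where
    row-Y : ∀ m → 1 * 2 + (1 * (4 + m * 2) + (suc m * 2 * 2 + 0)) ≡ 4 + m * 2 + (4 * suc m + 2)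
    row-Y = solve-∀
  quotient-linear Z = row-Z m
    where
    row-Z : ∀ m → 1 * 2 + (1 * (4 + m * 2) + suc m * 2 * 2) ≡ 4 + m * 2 + (4 * suc m + 2)
    row-Z = solve-∀
  quotient-linear P = twice-D-Y m
  quotient-linear Q = twice-D-Y m

  S N : ℕ
  S = ∑ᶜ (λ c → cellSize c * D³ c)
  N = ∑ᶜ (λ c → cellSize c * 1)

  S²<SN+CN² : S * S < S * N + (4 * suc m + 2) * (N * N)
  S²<SN+CN² = ≡.subst (S * S <_) (sym (excess t₀ m)) (ℕ.m<m+n (S * S) {E} (s≤s z≤n))
    where
    E = suc t₀ * suc t₀ * (8 * (suc m * suc m * (3 + m * 2)))
    excess : ∀ t₀ m →
      let t = suc t₀
          S = t * 2 + (t * (4 + m * 2) + (t * (4 + m * 2) + (t * suc m * 2 + t * suc m * 2)))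
          N = t * 1 + (t * 1 + (t * 1 + (t * suc m * 1 + t * suc m * 1)))
      in S * N + (4 * suc m + 2) * (N * N) ≡ S * S + t * t * (8 * (suc m * suc m * (3 + m * 2)))
    excess = solve-∀

H²-exactlyTwoMainEigenvalues : ∀ {r ℓ ℓ≤} (F : RealClosedField r ℓ ℓ≤) m t₀ →
                               Spectral.ExactlyTwoMainEigenvalues F (H² (suc m) (suc t₀))
H²-exactlyTwoMainEigenvalues F m t₀ =
  exactlyTwoMainEigenvalues F (4 * suc m) (λ u v → ℕ.+-comm (e² u v) (e² v u)) quotient-linear (ℕ.<⇒≢ S²<SN+CN²)
  where
  open H²-Partition (suc m) (suc t₀)
  open H²-Quotient m t₀
  open Equitable (Multigraph.w (H² (suc m) (suc t₀))) cell² cell²-constant B² equitable D² row-sums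

H³-exactlyTwoMainEigenvalues : ∀ {r ℓ ℓ≤} (F : RealClosedField r ℓ ℓ≤) m t₀ →
                               Spectral.ExactlyTwoMainEigenvalues F (H³ (suc m) (suc t₀))
H³-exactlyTwoMainEigenvalues F m t₀ =
  exactlyTwoMainEigenvalues F (4 * suc m + 2) (λ u v → ℕ.+-comm (e³ u v) (e³ v u)) quotient-linear (ℕ.<⇒≢ S²<SN+CN²)
  where
  open H³-Partition (suc m) (suc t₀)
  open H³-Quotient m t₀
  open Equitable (Multigraph.w (H³ (suc m) (suc t₀))) cell³ cell³-constant B³ equitable D³ row-sums

open import Data.Nat using (_≤_)
open import Data.Product using (_×_)

proposition3p14 : ∀ {c ℓ ℓ≤ : Level} (F : RealClosedField c ℓ ℓ≤) (k t : ℕ) →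
    1 ≤ k → 3 ≤ t →
    Spectral.ExactlyTwoMainEigenvalues F (H² k t) ×
    Spectral.ExactlyTwoMainEigenvalues F (H³ k t)
proposition3p14 F (suc m) (suc t₀) (s≤s z≤n) (s≤s _) =
  H²-exactlyTwoMainEigenvalues F m t₀ , H³-exactlyTwoMainEigenvalues F m t₀
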